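{- For all integers $n\ge 2$ and $m\ge 2$, $\lambda_2(\overrightarrow{C}_n\Box \overleftrightarrow{K}_m)=m$.
   Context: $\overrightarrow{C}_n$ denotes the directed cycle of order $n$, and $\overleftrightarrow{K}_m$ denotes the complete digraph of order $m$ (every ordered pair of distinct vertices is an arc). For a digraph $D$ and $S\subseteq V(D)$, an $S$-strong subgraph is a strongly connected subgraph of $D$ containing all vertices of $S$; $\lambda_S(D)$ is the maximum number of pairwise arc-disjoint $S$-strong subgraphs of $D$; and $\lambda_2(D)=\min\{\lambda_S(D): S\subseteq V(D),\ |S|=2\}$. The Cartesian product $G\Box H$ has vertex set $V(G)\times V(H)$, and $(x,x')(y,y')$ is an arc iff either $xy\in A(G)$ and $x'=y'$, or $x=y$ and $x'y'\in A(H)$. -}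

module Defs where

open import Level using (0ℓ)
open import Data.Nat using (ℕ; suc; _≤_; _%_; NonZero)
open import Data.Fin using (Fin; toℕ)
open import Data.Product using (Σ; ∃; _×_; _,_)
open import Data.Sum using (_⊎_)
open import Relation.Binary.PropositionalEquality using (_≡_; _≢_)
open import Relation.Binary.Construct.Closure.ReflexiveTransitive using (Star)

record Digraph : Set₁ where
  field
    V   : Set
    Arc : V → V → Set
open Digraph public

record Subgraph (D : Digraph) : Set₁ where
  field
    VH      : V D → Set
    AH      : V D → V D → Set
    AH⊆A    : ∀ {u v} → AH u v → Arc D u v
    AH-ends : ∀ {u v} → AH u v → VH u × VH v
open Subgraph public

StronglyConnected : {D : Digraph} → Subgraph D → Set
StronglyConnected H = ∀ u v → VH H u → VH H v → Star (AH H) u v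

IsSStrong : {D : Digraph} → V D → V D → Subgraph D → Set
IsSStrong x y H = VH H x × VH H y × StronglyConnected H

ArcDisjoint : {D : Digraph} {k : ℕ} → (Fin k → Subgraph D) → Set
ArcDisjoint {D} {k} F =
  ∀ (i j : Fin k) → i ≢ j → ∀ u v → AH (F i) u v → AH (F j) u v → Data.Empty.⊥
  where import Data.Empty

HasArcDisjointSStrong : (D : Digraph) → V D → V D → ℕ → Set₁
HasArcDisjointSStrong D x y k =
  Σ (Fin k → Subgraph D) λ F → (∀ i → IsSStrong x y (F i)) × ArcDisjoint F

LambdaS≡ : (D : Digraph) → V D → V D → ℕ → Set₁
LambdaS≡ D x y k =
  HasArcDisjointSStrong D x y k × (∀ j → HasArcDisjointSStrong D x y j → j ≤ k)

Lambda2≡ : Digraph → ℕ → Set₁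
Lambda2≡ D k =
  (∀ x y → x ≢ y → ∀ j → LambdaS≡ D x y j → k ≤ j)
  × (Σ (V D) λ x → Σ (V D) λ y → x ≢ y × LambdaS≡ D x y k)

-- Directed cycle C_n on Fin n: arcs i → i+1 (mod n).
-- i.e. toℕ j = toℕ i + 1, or i is the last vertex n-1 and j = 0.
Cycle : ℕ → Digraph
Cycle n = record
  { V   = Fin n
  ; Arc = λ i j → (toℕ j ≡ suc (toℕ i)) ⊎ (suc (toℕ i) ≡ n × toℕ j ≡ 0)
  }

Complete : ℕ → Digraph
Complete m = record { V = Fin m ; Arc = λ i j → i ≢ j }

_□_ : Digraph → Digraph → Digraph
G □ H = record
  { V   = V G × V H
  ; Arc = λ { (x , x') (y , y') → (Arc G x y × x' ≡ y') ⊎ (x ≡ y × Arc H x' y') }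
  }

-- Upper bound: every {x,y}-strong subgraph leaves x along an arc, and the m out-arcs of x
-- in C_n □ K_m have pairwise distinct K_m-coordinates at their heads.
-- Lower bound: for colour c take the copy of C_n at level c together with the K_m-arcs
-- joining x and y to that copy ("spokes"); these m subgraphs are arc-disjoint when x and y
-- lie in different copies of K_m. When they lie in the same copy, the colours b and b' of x
-- and y are handled separately: one subgraph is the 2-cycle x ⇄ y, another consists of the
-- two cycle copies at levels b and b', joined by a 2-cycle in some other copy of K_m.
module Submission where

open import Defs
open import Level using (0ℓ)
open import Data.Nat using (ℕ; zero; suc; _≤_; z≤n; s≤s)
open import Data.Fin using (Fin; toℕ; fromℕ; punchIn) renaming (zero to fzero; suc to fsuc)
open import Data.Fin.Properties using (_≟_; toℕ-injective; toℕ-fromℕ; toℕ<n; injective⇒≤; punchInᵢ≢i)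
open import Data.Nat.Properties using (<-irrefl)
open import Data.Product as Product using (∃; _×_; _,_; proj₁; proj₂)
open import Data.Sum using (_⊎_; inj₁; inj₂; [_,_])
open import Data.Empty using (⊥; ⊥-elim)
open import Function using (_∘_; id)
open import Relation.Nullary using (yes; no)
open import Relation.Unary using (Pred)
open import Relation.Binary.Core using (Rel; _⇒_)
open import Relation.Binary.Construct.Union using (_∪_)
open import Relation.Binary.PropositionalEquality using (_≡_; _≢_; refl; sym; trans; cong; subst)
open import Relation.Binary.Construct.Closure.ReflexiveTransitive as Star
  using (Star; ε; _◅_; _◅◅_; gmap; return)

Bireachable : {A : Set} → Rel A 0ℓ → A → A → Set
Bireachable R u v = Star R u v × Star R v u

ThroughHub : {A : Set} → Rel A 0ℓ → A → Set
ThroughHub R h = ∀ {u v} → R u v → Star R h u × Star R v h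

map-walks : {A : Set} {R R' : Rel A 0ℓ} {u v u' v' : A} → R ⇒ R' →
            Star R u v × Star R u' v' → Star R' u v × Star R' u' v'
map-walks f = Product.map (Star.map f) (Star.map f)

first-arc : {A : Set} {R : Rel A 0ℓ} {x y : A} → x ≢ y → Star R x y → ∃ (R x)
first-arc x≢y ε       = ⊥-elim (x≢y refl)
first-arc x≢y (e ◅ _) = _ , e

module _ {D : Digraph} where

  hubSubgraph : {R : Rel (V D) 0ℓ} → R ⇒ Arc D → (h : V D) → ThroughHub R h → Subgraph D
  hubSubgraph {R} R⊆Arc h through = record
    { VH      = λ w → Bireachable R w h
    ; AH      = R
    ; AH⊆A    = R⊆Arc
    ; AH-ends = λ r → let (h↝u , v↝h) = through r
                      in (r ◅ v↝h , h↝u) , (v↝h , h↝u ◅◅ return r)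
    }

  hubSubgraph-strong : {R : Rel (V D) 0ℓ} (R⊆Arc : R ⇒ Arc D) (h : V D) (through : ThroughHub R h) →
                       StronglyConnected (hubSubgraph R⊆Arc h through)
  hubSubgraph-strong _ _ _ u v (u↝h , _) (_ , h↝v) = u↝h ◅◅ h↝v

  record HubFamily (x y : V D) (k : ℕ) : Set₁ where
    field
      Arcs          : Fin k → Rel (V D) 0ℓ
      hub           : Fin k → V D
      Arcs⊆Arc      : ∀ c → Arcs c ⇒ Arc D
      throughHub    : ∀ c → ThroughHub (Arcs c) (hub c)
      terminals↔hub : ∀ c → Bireachable (Arcs c) x (hub c) × Bireachable (Arcs c) y (hub c)
      owner-unique  : ∀ {c c' u v} → Arcs c u v → Arcs c' u v → c ≡ c'

  hubFamily⇒arcDisjointSStrong : {x y : V D} {k : ℕ} → HubFamily x y k → HasArcDisjointSStrong D x y k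
  hubFamily⇒arcDisjointSStrong family = F , sStrong , λ i j i≢j _ _ r r' → i≢j (owner-unique r r')
    where
    open HubFamily family
    F : Fin _ → Subgraph D
    F c = hubSubgraph (Arcs⊆Arc c) (hub c) (throughHub c)
    sStrong : ∀ c → IsSStrong _ _ (F c)
    sStrong c = proj₁ (terminals↔hub c) , proj₂ (terminals↔hub c)
              , hubSubgraph-strong (Arcs⊆Arc c) (hub c) (throughHub c)

  arcDisjointSStrong≤ : {x y : V D} {m : ℕ} (f : V D → Fin m) →
                        (∀ {z z'} → Arc D x z → Arc D x z' → f z ≡ f z' → z ≡ z') →
                        x ≢ y → ∀ {k} → HasArcDisjointSStrong D x y k → k ≤ m
  arcDisjointSStrong≤ {x} {y} f f-injective x≢y (F , sStrong , disjoint) = injective⇒≤ injective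
    where
    exit : ∀ i → ∃ (AH (F i) x)
    exit i = let (x∈ , y∈ , strong) = sStrong i in first-arc x≢y (strong x y x∈ y∈)
    injective : ∀ {i j} → f (proj₁ (exit i)) ≡ f (proj₁ (exit j)) → i ≡ j
    injective {i} {j} same-f with i ≟ j
    ... | yes i≡j = i≡j
    ... | no i≢j  = ⊥-elim (disjoint i j i≢j x _ (subst (AH (F i) x) same-head (proj₂ (exit i))) (proj₂ (exit j)))
      where
      same-head = f-injective (AH⊆A (F i) (proj₂ (exit i))) (AH⊆A (F j) (proj₂ (exit j))) same-f

  lambda2≡ : {k : ℕ} → (∀ x y → x ≢ y → LambdaS≡ D x y k) → (x y : V D) → x ≢ y → Lambda2≡ D k
  lambda2≡ {k} λS x y x≢y =
    (λ u v u≢v j λS≡j → proj₂ λS≡j k (proj₁ (λS u v u≢v))) , x , y , x≢y , λS x y x≢y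

Successor : {n : ℕ} → Rel (Fin n) 0ℓ
Successor i j = toℕ j ≡ suc (toℕ i)

successor-from-zero : ∀ {k} (j : Fin (suc k)) → Star Successor fzero j
successor-from-zero fzero          = ε
successor-from-zero {suc k} (fsuc j) = refl ◅ gmap fsuc (cong suc) (successor-from-zero j)

successor-to-last : ∀ {k} (i : Fin (suc k)) → Star Successor i (fromℕ k)
successor-to-last {zero}  fzero    = ε
successor-to-last {suc k} fzero    = refl ◅ gmap fsuc (cong suc) (successor-to-last fzero)
successor-to-last {suc k} (fsuc i) = gmap fsuc (cong suc) (successor-to-last i)

cycle-walk : ∀ {k} (i j : Fin (suc k)) → Star (Arc (Cycle (suc k))) i j
cycle-walk {k} i j =
  Star.map inj₁ (successor-to-last i) ◅◅ inj₂ (cong suc (toℕ-fromℕ k) , refl) ◅ Star.map inj₁ (successor-from-zero j)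

cycle-functional : ∀ {n} {i j j' : Fin n} → Arc (Cycle n) i j → Arc (Cycle n) i j' → j ≡ j'
cycle-functional (inj₁ j≡i+1) (inj₁ j'≡i+1)  = toℕ-injective (trans j≡i+1 (sym j'≡i+1))
cycle-functional {j = j} (inj₁ j≡i+1) (inj₂ (i+1≡n , _)) = ⊥-elim (<-irrefl (trans j≡i+1 i+1≡n) (toℕ<n j))
cycle-functional {j' = j'} (inj₂ (i+1≡n , _)) (inj₁ j'≡i+1) = ⊥-elim (<-irrefl (trans j'≡i+1 i+1≡n) (toℕ<n j'))
cycle-functional (inj₂ (_ , j≡0)) (inj₂ (_ , j'≡0)) = toℕ-injective (trans j≡0 (sym j'≡0))

private
  variable
    n m : ℕ
    c c' : Fin m
    u v : Fin n × Fin m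
    T T' : Pred (Fin n × Fin m) 0ℓ

head-colour-injective : ∀ {a b} {z z' : Fin n × Fin m} →
                        Arc (Cycle n □ Complete m) (a , b) z → Arc (Cycle n □ Complete m) (a , b) z' →
                        proj₂ z ≡ proj₂ z' → z ≡ z'
head-colour-injective {z = _ , _} {_ , _} (inj₁ (e , refl)) (inj₁ (e' , refl)) _ = cong (_, _) (cycle-functional e e')
head-colour-injective {z = _ , _} {_ , _} (inj₁ (_ , refl)) (inj₂ (refl , b≢q')) b≡q' = ⊥-elim (b≢q' b≡q')
head-colour-injective {z = _ , _} {_ , _} (inj₂ (refl , b≢q)) (inj₁ (_ , refl)) q≡b = ⊥-elim (b≢q (sym q≡b))
head-colour-injective {z = _ , _} {_ , _} (inj₂ (refl , _)) (inj₂ (refl , _)) refl = refl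

data Column {n m : ℕ} (c : Fin m) : Rel (Fin n × Fin m) 0ℓ where
  along : ∀ {i j} → Arc (Cycle n) i j → Column c (i , c) (j , c)

data Spoke {n m : ℕ} (T : Pred (Fin n × Fin m) 0ℓ) (c : Fin m) : Rel (Fin n × Fin m) 0ℓ where
  inward  : ∀ {h p} → T (h , p) → p ≢ c → Spoke T c (h , p) (h , c)
  outward : ∀ {h p} → T (h , p) → p ≢ c → Spoke T c (h , c) (h , p)

Spoked : {n m : ℕ} → Pred (Fin n × Fin m) 0ℓ → Fin m → Rel (Fin n × Fin m) 0ℓ
Spoked T c = Column c ∪ Spoke T c

column⊆arc : Column c u v → Arc (Cycle n □ Complete m) u v
column⊆arc (along e) = inj₁ (e , refl)

spoke⊆arc : Spoke T c u v → Arc (Cycle n □ Complete m) u v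
spoke⊆arc (inward _ p≢c)  = inj₂ (refl , p≢c)
spoke⊆arc (outward _ p≢c) = inj₂ (refl , p≢c ∘ sym)

spoked⊆arc : Spoked T c u v → Arc (Cycle n □ Complete m) u v
spoked⊆arc = [ column⊆arc , spoke⊆arc ]

column-unique : Column c u v → Column c' u v → c ≡ c'
column-unique (along _) (along _) = refl

column-spoke-disjoint : Column c u v → Spoke T c' u v → ⊥
column-spoke-disjoint (along _) (inward _ c≢c)  = c≢c refl
column-spoke-disjoint (along _) (outward _ c≢c) = c≢c refl

spoke-unique : Spoke T c u v → Spoke T' c' u v → c ≡ c' ⊎ ∃ λ h → T (h , c') × T' (h , c)
spoke-unique (inward _ _)  (inward _ _)   = inj₁ refl
spoke-unique (inward t _)  (outward t' _) = inj₂ (_ , t , t')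
spoke-unique (outward t _) (inward t' _)  = inj₂ (_ , t , t')
spoke-unique (outward _ _) (outward _ _)  = inj₁ refl

spoked-unique : Spoked T c u v → Spoked T' c' u v → c ≡ c' ⊎ ∃ λ h → T (h , c') × T' (h , c)
spoked-unique (inj₁ col) (inj₁ col') = inj₁ (column-unique col col')
spoked-unique (inj₁ col) (inj₂ s)    = ⊥-elim (column-spoke-disjoint col s)
spoked-unique (inj₂ s)   (inj₁ col)  = ⊥-elim (column-spoke-disjoint col s)
spoked-unique (inj₂ s)   (inj₂ s')   = spoke-unique s s'

column-spoked-unique : Column c u v → Spoked T c' u v → c ≡ c'
column-spoked-unique col (inj₁ col') = column-unique col col'
column-spoked-unique col (inj₂ s)    = ⊥-elim (column-spoke-disjoint col s)

column-walk : ∀ {k m} {c : Fin m} (i j : Fin (suc k)) → Star (Column c) (i , c) (j , c)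
column-walk {c = c} i j = gmap (_, c) along (cycle-walk i j)

module _ {k m : ℕ} {T : Pred (Fin (suc k) × Fin m) 0ℓ} {c : Fin m} where

  private
    walk : (i j : Fin (suc k)) → Star (Spoked T c) (i , c) (j , c)
    walk i j = Star.map inj₁ (column-walk i j)

  spoked-throughHub : (h₀ : Fin (suc k)) → ThroughHub (Spoked T c) (h₀ , c)
  spoked-throughHub h₀ (inj₁ (along {i} {j} _))   = walk h₀ i , walk j h₀
  spoked-throughHub h₀ (inj₂ (inward {h} t p≢c))  = walk h₀ h ◅◅ return (inj₂ (outward t p≢c)) , walk h h₀
  spoked-throughHub h₀ (inj₂ (outward {h} t p≢c)) = walk h₀ h , inj₂ (inward t p≢c) ◅ walk h h₀

  terminal↔column : ∀ {h p} → T (h , p) → (h₀ : Fin (suc k)) → Bireachable (Spoked T c) (h , p) (h₀ , c)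
  terminal↔column {h} {p} t h₀ with p ≟ c
  ... | yes refl = walk h h₀ , walk h₀ h
  ... | no p≢c   = inj₂ (inward t p≢c) ◅ walk h h₀ , walk h₀ h ◅◅ return (inj₂ (outward t p≢c))

module Apart {k m : ℕ} (a a' : Fin (suc k)) (b b' : Fin m) (a≢a' : a ≢ a') where

  Terminal : Pred (Fin (suc k) × Fin m) 0ℓ
  Terminal w = w ≡ (a , b) ⊎ w ≡ (a' , b')

  terminal-colour-unique : ∀ {h c c'} → Terminal (h , c) → Terminal (h , c') → c ≡ c'
  terminal-colour-unique (inj₁ refl) (inj₁ refl) = refl
  terminal-colour-unique (inj₁ refl) (inj₂ refl) = ⊥-elim (a≢a' refl)
  terminal-colour-unique (inj₂ refl) (inj₁ refl) = ⊥-elim (a≢a' refl)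
  terminal-colour-unique (inj₂ refl) (inj₂ refl) = refl

  family : HubFamily {Cycle (suc k) □ Complete m} (a , b) (a' , b') m
  family = record
    { Arcs          = Spoked Terminal
    ; hub           = a ,_
    ; Arcs⊆Arc      = λ _ → spoked⊆arc
    ; throughHub    = λ _ → spoked-throughHub a
    ; terminals↔hub = λ _ → terminal↔column (inj₁ refl) a , terminal↔column (inj₂ refl) a
    ; owner-unique  = λ r r' → [ id , (λ (_ , t' , t) → terminal-colour-unique t t') ] (spoked-unique r r')
    }

module Together {k m : ℕ} (a o : Fin (suc k)) (b b' : Fin m) (o≢a : o ≢ a) (b≢b' : b ≢ b') where

  Terminal : Pred (Fin (suc k) × Fin m) 0ℓ
  Terminal w = w ≡ (a , b) ⊎ w ≡ (a , b')

  Joined : Rel (Fin (suc k) × Fin m) 0ℓ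
  Joined = Column b ∪ Spoked (_≡ (o , b)) b'

  data Bridged : Fin m → Rel (Fin (suc k) × Fin m) 0ℓ where
    swap   : ∀ {u v} → Spoke (_≡ (a , b')) b u v → Bridged b u v
    joined : ∀ {u v} → Joined u v → Bridged b' u v
    via    : ∀ {c u v} → c ≢ b → c ≢ b' → Spoked Terminal c u v → Bridged c u v

  bridged⊆arc : ∀ {c} → Bridged c ⇒ Arc (Cycle (suc k) □ Complete m)
  bridged⊆arc (swap s)            = spoke⊆arc s
  bridged⊆arc (joined (inj₁ col)) = column⊆arc col
  bridged⊆arc (joined (inj₂ r))   = spoked⊆arc r
  bridged⊆arc (via _ _ r)         = spoked⊆arc r

  column-b↔hub : ∀ i → Bireachable Joined (i , b) (a , b')
  column-b↔hub i = let (o↝hub , hub↝o) = map-walks inj₂ (terminal↔column refl a)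
                   in Star.map inj₁ (column-walk i o) ◅◅ o↝hub , hub↝o ◅◅ Star.map inj₁ (column-walk o i)

  bridged-throughHub : ∀ {c} → ThroughHub (Bridged c) (a , c)
  bridged-throughHub (swap (inward refl b'≢b))  = return (swap (outward refl b'≢b)) , ε
  bridged-throughHub (swap (outward refl b'≢b)) = ε , return (swap (inward refl b'≢b))
  bridged-throughHub (joined (inj₁ (along {i} {j} _))) =
    map-walks joined (proj₂ (column-b↔hub i) , proj₁ (column-b↔hub j))
  bridged-throughHub (joined (inj₂ r)) = map-walks (joined ∘ inj₂) (spoked-throughHub a r)
  bridged-throughHub (via c≢b c≢b' r) = map-walks (via c≢b c≢b') (spoked-throughHub a r)

  terminals↔hub : ∀ c → Bireachable (Bridged c) (a , b) (a , c) × Bireachable (Bridged c) (a , b') (a , c)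
  terminals↔hub c with c ≟ b | c ≟ b'
  ... | yes refl | _        = (ε , ε) , return (swap (inward refl (b≢b' ∘ sym))) , return (swap (outward refl (b≢b' ∘ sym)))
  ... | no _     | yes refl = map-walks joined (column-b↔hub a) , ε , ε
  ... | no c≢b   | no c≢b'  = map-walks (via c≢b c≢b') (terminal↔column (inj₁ refl) a)
                            , map-walks (via c≢b c≢b') (terminal↔column (inj₂ refl) a)

  terminal-colour : ∀ {h c} → Terminal (h , c) → c ≡ b ⊎ c ≡ b'
  terminal-colour (inj₁ refl) = inj₁ refl
  terminal-colour (inj₂ refl) = inj₂ refl

  swap-joined-disjoint : ∀ {u v} → Spoke (_≡ (a , b')) b u v → Joined u v → ⊥
  swap-joined-disjoint s (inj₁ col) = column-spoke-disjoint col s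
  swap-joined-disjoint s (inj₂ r) with spoked-unique (inj₂ s) r
  ... | inj₁ b≡b'              = b≢b' b≡b'
  ... | inj₂ (_ , refl , refl) = o≢a refl

  swap-via-disjoint : ∀ {c u v} → c ≢ b → c ≢ b' → Spoke (_≡ (a , b')) b u v → Spoked Terminal c u v → ⊥
  swap-via-disjoint c≢b c≢b' s r with spoked-unique (inj₂ s) r
  ... | inj₁ b≡c            = c≢b (sym b≡c)
  ... | inj₂ (_ , refl , _) = c≢b' refl

  joined-via-disjoint : ∀ {c u v} → c ≢ b → c ≢ b' → Joined u v → Spoked Terminal c u v → ⊥
  joined-via-disjoint c≢b c≢b' (inj₁ col) r = c≢b (sym (column-spoked-unique col r))
  joined-via-disjoint c≢b c≢b' (inj₂ j) r with spoked-unique j r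
  ... | inj₁ b'≡c           = c≢b' (sym b'≡c)
  ... | inj₂ (_ , refl , _) = c≢b refl

  bridged-owner-unique : ∀ {c c' u v} → Bridged c u v → Bridged c' u v → c ≡ c'
  bridged-owner-unique (swap _)   (swap _)   = refl
  bridged-owner-unique (swap s)   (joined j) = ⊥-elim (swap-joined-disjoint s j)
  bridged-owner-unique (swap s)   (via c≢b c≢b' r) = ⊥-elim (swap-via-disjoint c≢b c≢b' s r)
  bridged-owner-unique (joined j) (swap s)   = ⊥-elim (swap-joined-disjoint s j)
  bridged-owner-unique (joined _) (joined _) = refl
  bridged-owner-unique (joined j) (via c≢b c≢b' r) = ⊥-elim (joined-via-disjoint c≢b c≢b' j r)
  bridged-owner-unique (via c≢b c≢b' r) (swap s)   = ⊥-elim (swap-via-disjoint c≢b c≢b' s r)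
  bridged-owner-unique (via c≢b c≢b' r) (joined j) = ⊥-elim (joined-via-disjoint c≢b c≢b' j r)
  bridged-owner-unique (via c≢b c≢b' r) (via _ _ r') with spoked-unique r r'
  ... | inj₁ c≡c'        = c≡c'
  ... | inj₂ (_ , _ , t) = ⊥-elim ([ c≢b , c≢b' ] (terminal-colour t))

  family : HubFamily {Cycle (suc k) □ Complete m} (a , b) (a , b') m
  family = record
    { Arcs          = Bridged
    ; hub           = a ,_
    ; Arcs⊆Arc      = λ _ → bridged⊆arc
    ; throughHub    = λ _ → bridged-throughHub
    ; terminals↔hub = terminals↔hub
    ; owner-unique  = bridged-owner-unique
    }

product-arcDisjointSStrong : ∀ {k m} (x y : Fin (suc (suc k)) × Fin m) → x ≢ y →
                             HasArcDisjointSStrong (Cycle (suc (suc k)) □ Complete m) x y m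
product-arcDisjointSStrong (a , b) (a' , b') x≢y with a ≟ a'
... | no a≢a' = hubFamily⇒arcDisjointSStrong (Apart.family a a' b b' a≢a')
... | yes refl = hubFamily⇒arcDisjointSStrong
                   (Together.family a (punchIn a fzero) b b' (punchInᵢ≢i a fzero) (x≢y ∘ cong (a ,_)))

product-lambdaS : ∀ {k m} (x y : Fin (suc (suc k)) × Fin m) → x ≢ y →
                  LambdaS≡ (Cycle (suc (suc k)) □ Complete m) x y m
product-lambdaS x y x≢y =
  product-arcDisjointSStrong x y x≢y , λ _ → arcDisjointSStrong≤ proj₂ head-colour-injective x≢y

proposition5p4 : (n m : ℕ) → 2 ≤ n → 2 ≤ m →
    Lambda2≡ (Cycle n □ Complete m) m
proposition5p4 (suc (suc k)) (suc m) (s≤s (s≤s z≤n)) (s≤s _) =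
  lambda2≡ product-lambdaS (fzero , fzero) (fsuc fzero , fzero) λ ()
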